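{- Let $\lambda$ and $\mu$ be partitions with $\mu\subset\lambda$ such that $\lambda/\mu$ is a horizontal strip, let $r,l$ be positive integers and $\zeta$ a primitive $l$-th root of unity. Then $$\psi_{\lambda\cup(r^l)/\mu\cup(r^l)}(q,\zeta)=\psi_{\lambda/\mu}(q,\zeta).$$
   Context: Let $F=\mathbb{Q}(q,t)$. $P_\lambda(x;q,t)$ are the Macdonald polynomials (orthogonalization of the Schur basis, ordered compatibly with dominance, for $\langle p_\lambda,p_\mu\rangle_{q,t}=\delta_{\lambda\mu}z_\lambda(q,t)$, $z_\lambda(q,t)=\prod_i m_i(\lambda)!\,i^{m_i(\lambda)}\prod_i\frac{1-q^{\lambda_i}}{1-t^{\lambda_i}}$), $Q_\lambda=P_\lambda/\langle P_\lambda,P_\lambda\rangle_{q,t}$, and $g_k(x;q,t)=\sum_{|\rho|=k}z_\rho(q,t)^{ -1}p_\rho$. The rational functions $\psi_{\lambda/\mu}(q,t)$ are the Pieri coefficients defined by $Q_\mu(x;q,t)\,g_k(x;q,t)=\sum_\lambda\psi_{\lambda/\mu}(q,t)\,Q_\lambda(x;q,t)$ (the sum being over $\lambda$ with $\lambda/\mu$ a horizontal $k$-strip); equivalently, with $b_\nu(s)=\frac{1-q^{a_\nu(s)}t^{l_\nu(s)+1}}{1-q^{a_\nu(s)+1}t^{l_\nu(s)}}$ ($a_\nu(s),l_\nu(s)$ the arm and leg lengths of the cell $s$ in $\nu$), $\psi_{\lambda/\mu}=\prod_{s}b_\mu(s)/b_\lambda(s)$ over the cells $s$ lying in a row but not in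 a column meeting $\lambda/\mu$. For a partition $\nu$, $\nu\cup(r^l)$ denotes the partition whose parts are those of $\nu$ together with $l$ additional parts equal to $r$. $\psi(q,\zeta)$ is the specialization $t=\zeta$. -}

module Defs where

open import Level using (Level; _⊔_)
open import Data.Nat using (ℕ; zero; suc; _<_; _≥_; _≤_; _<?_; _≟_; _∸_)
open import Data.List using (List; []; _∷_; length; filter; map; foldr; concat; zipWith; upTo; replicate; _++_)
open import Data.List.Relation.Unary.All using (All)
open import Data.List.Relation.Unary.Linked using (Linked)
open import Data.Product using (_×_; _,_; ∃)
open import Data.Bool using (Bool; if_then_else_; _∧_)
open import Relation.Nullary using (¬_; does)
open import Relation.Binary.PropositionalEquality using (_≡_)
open import Algebra.Bundles using (CommutativeRing; Semiring)
import Algebra.Definitions.RawSemiring as RawSR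

record Field (c ℓ : Level) : Set (Level.suc (c ⊔ ℓ)) where
  field
    commutativeRing : CommutativeRing c ℓ
  open CommutativeRing commutativeRing public
  field
    1≉0     : ¬ (1# ≈ 0#)
    inverse : ∀ x → ¬ (x ≈ 0#) → ∃ λ y → x * y ≈ 1#

module FieldOps {c ℓ} (K : Field c ℓ) where
  open Field K
  open RawSR (Semiring.rawSemiring semiring) public using (_^_) renaming (_×_ to _·1×_)

  CharZero : Set ℓ
  CharZero = ∀ n → (n ·1× 1#) ≈ 0# → n ≡ 0

  PrimitiveRoot : ℕ → Carrier → Set ℓ
  PrimitiveRoot l ζ = (ζ ^ l) ≈ 1# × (∀ k → 1 ≤ k → k < l → ¬ ((ζ ^ k) ≈ 1#))

  -- Univariate polynomials K[q] as coefficient lists (constant term first),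
  -- compared coefficientwise (so trailing zeros are irrelevant).

  Poly : Set c
  Poly = List Carrier

  coeff : Poly → ℕ → Carrier
  coeff []       _       = 0#
  coeff (a ∷ p)  zero    = a
  coeff (a ∷ p)  (suc i) = coeff p i

  _≈P_ : Poly → Poly → Set ℓ
  p ≈P p′ = ∀ i → coeff p i ≈ coeff p′ i

  0P 1P : Poly
  0P = []
  1P = 1# ∷ []

  _+P_ : Poly → Poly → Poly
  []      +P p′       = p′
  (a ∷ p) +P []       = a ∷ p
  (a ∷ p) +P (b ∷ p′) = (a + b) ∷ (p +P p′)

  _*P_ : Poly → Poly → Poly
  []      *P p′ = []
  (a ∷ p) *P p′ = map (a *_) p′ +P (0# ∷ (p *P p′))

  mono : Carrier → ℕ → Poly
  mono a n = replicate n 0# ++ (a ∷ [])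

  oneMinus : Carrier → ℕ → ℕ → Poly
  oneMinus t a b = 1P +P mono (- (t ^ b)) a

IsPartition : List ℕ → Set
IsPartition ν = Linked _≥_ ν × All (λ x → 1 ≤ x) ν

-- i-th part (0-indexed), 0 beyond the length
part : List ℕ → ℕ → ℕ
part []       _       = 0
part (x ∷ xs) zero    = x
part (x ∷ xs) (suc i) = part xs i

-- j-th part of the conjugate partition (0-indexed): #{k : ν_k > j}
conj : List ℕ → ℕ → ℕ
conj ν j = length (filter (λ x → j <? x) ν)

_⊆ₚ_ : List ℕ → List ℕ → Set
μ ⊆ₚ λ′ = ∀ i → part μ i ≤ part λ′ i

-- λ/μ is a horizontal strip: at most one cell in each column
HorizontalStrip : List ℕ → List ℕ → Set
HorizontalStrip λ′ μ = ∀ j → conj λ′ j ≤ suc (conj μ j)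

insertPart : ℕ → List ℕ → List ℕ
insertPart r []       = r ∷ []
insertPart r (x ∷ xs) = if does (x <? r) then r ∷ x ∷ xs else x ∷ insertPart r xs

_∪_^_ : List ℕ → ℕ → ℕ → List ℕ
ν ∪ r ^ zero  = ν
ν ∪ r ^ suc l = insertPart r (ν ∪ r ^ l)

-- cells (i , j) of ν, 0-indexed: i < length ν, j < ν_i
cells : List ℕ → List (ℕ × ℕ)
cells ν = concat (zipWith (λ i n → map (λ j → (i , j)) (upTo n)) (upTo (length ν)) ν)

arm leg : List ℕ → ℕ × ℕ → ℕ
arm ν (i , j) = part ν i ∸ j ∸ 1
leg ν (i , j) = conj ν j ∸ i ∸ 1

-- Pieri coefficient ψ_{λ/μ}(q,t) for t ∈ K, as numerator/denominator in K[q]: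
-- b_ν(s) = (1 - q^{a} t^{l+1}) / (1 - q^{a+1} t^{l}),
-- ψ_{λ/μ} = ∏_{s ∈ R_{λ/μ} - C_{λ/μ}} b_μ(s) / b_λ(s).
module Pieri {c ℓ} (K : Field c ℓ) where
  open Field K using (Carrier)
  open FieldOps K

  bNum bDen : Carrier → List ℕ → ℕ × ℕ → Poly
  bNum t ν s = oneMinus t (arm ν s) (suc (leg ν s))
  bDen t ν s = oneMinus t (suc (arm ν s)) (leg ν s)

  -- s lies in a row meeting λ/μ but not in a column meeting λ/μ
  inRnotC : List ℕ → List ℕ → ℕ × ℕ → Bool
  inRnotC λ′ μ (i , j) = does (part μ i <? part λ′ i) ∧ does (conj λ′ j ≟ conj μ j)

  ∏P : List Poly → Poly
  ∏P = foldr _*P_ 1P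

  -- (the cells s in R_{λ/μ} - C_{λ/μ} are cells of μ)
  ψNum ψDen : Carrier → List ℕ → List ℕ → Poly
  ψNum t λ′ μ = ∏P (map (λ s → if inRnotC λ′ μ s then bNum t μ s *P bDen t λ′ s else 1P) (cells μ))
  ψDen t λ′ μ = ∏P (map (λ s → if inRnotC λ′ μ s then bDen t μ s *P bNum t λ′ s else 1P) (cells μ))

{-# OPTIONS --safe #-}
module Submission where

-- ψ_{λ/μ} is computed row by row.  As λ/μ is a horizontal strip, λ₁ ≥ μ₁ ≥ λ₂ ≥ μ₂ ≥ ⋯, and a cell
-- (i, j) of μ contributes to ψ only if μᵢ < λᵢ and column j holds equally many cells of λ and μ below
-- row i; that common number is its leg in both λ and μ.  Inserting l parts r into both partitions
-- raises these legs by l in the columns j < r, which is invisible at t = ζ since ζ^l = 1, and adds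
-- pairs of equal rows (r, r), which contribute nothing.  The only real change is at the first pair
-- (λᵢ, μᵢ) with μᵢ < r ≤ λᵢ, which becomes (λᵢ, r), (r, r), …, (r, μᵢ): there the factors b_μ/b_λ
-- telescope, so numerator and denominator of ψ pick up the same polynomial factor, which gives the
-- cross-multiplied identity.  The denominators have constant term 1, so they do not vanish.

open import Defs
open import Level using (Level)
open import Data.Nat using (ℕ; _≤_)
open import Data.List using (List)
open import Data.Product using (_×_)
open import Relation.Nullary using (¬_)

open import Data.Nat as Nat using (zero; suc; _∸_; _<_; _≥_; z≤n; s≤s; s≤s⁻¹; _<?_; _<ᵇ_; _≟_)
open import Data.Nat.Properties
  using ( ≤-refl; ≤-reflexive; ≤-trans; <-irrefl; <-trans; <-≤-trans; ≤-<-trans; n≤1+n; <⇒≤; <⇒≱; <⇒≯; ≤⇒≯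
        ; ≰⇒>; ≮⇒≥; ≤∧≮⇒≡; _≤?_; m+[n∸m]≡n; m≤m+n; +-monoʳ-<; +-monoʳ-≤; +-suc )
open import Data.List using ([]; _∷_; _++_; map; concat; zipWith; upTo; applyUpTo; length; replicate)
open import Data.List.Properties using (map-++; map-∘; map-upTo; filter-accept; filter-reject)
open import Data.List.Relation.Unary.All as All using (All; []; _∷_)
open import Data.List.Relation.Unary.Linked as Linked using (Linked; []; _∷_)
open import Data.List.Relation.Unary.Linked.Properties using (Linked⇒All)
open import Data.List.Relation.Binary.Permutation.Propositional using (_↭_; prep; swap; ↭-refl; ↭-trans)
open import Data.List.Relation.Binary.Permutation.Propositional.Properties using (↭-length; filter-↭)
open import Data.Product using (_,_; proj₁; curry)
open import Data.Empty using (⊥-elim)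
open import Data.Bool using (true; false; if_then_else_; _∧_)
open import Data.Bool.Properties using (∧-zeroʳ)
open import Relation.Nullary using (Dec; yes; no; does)
open import Relation.Nullary.Decidable using (dec-true; dec-false)
open import Relation.Binary.Bundles using (Setoid)
open import Relation.Binary.PropositionalEquality as ≡ using (_≡_; _≢_)
import Relation.Binary.Reasoning.Setoid as SetoidReasoning
open import Algebra.Bundles using (CommutativeMonoid; CommutativeSemigroup)
import Algebra.Properties.CommutativeSemigroup as CommutativeSemigroupProperties
import Algebra.Properties.Semiring.Exp as Exp
import Algebra.Solver.CommutativeMonoid as CommutativeMonoidSolver

-- Polynomial arithmetic

module PolynomialAlgebra {c ℓ} (K : Field c ℓ) where
  open Field K
  open FieldOps K

  -- A record around _≈P_, so that the two polynomials can be inferred from a proof.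
  infix 4 _≋_
  record _≋_ (p p′ : Poly) : Set ℓ where
    constructor mk≋
    field coeff-≈ : p ≈P p′
  open _≋_ public

  ≋-setoid : Setoid c ℓ
  ≋-setoid = record
    { Carrier = Poly
    ; _≈_ = _≋_
    ; isEquivalence = record
      { refl  = mk≋ λ _ → refl
      ; sym   = λ (mk≋ e) → mk≋ λ i → sym (e i)
      ; trans = λ (mk≋ e) (mk≋ f) → mk≋ λ i → trans (e i) (f i)
      }
    }

  open Setoid ≋-setoid public using () renaming (refl to ≋-refl; sym to ≋-sym; trans to ≋-trans)

  ≡⇒≋ : ∀ {p p′} → p ≡ p′ → p ≋ p′
  ≡⇒≋ ≡.refl = ≋-refl

  if-cong : ∀ t {p p′ q} → p ≋ p′ → (if t then p else q) ≋ (if t then p′ else q)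
  if-cong true  p≋p′ = p≋p′
  if-cong false p≋p′ = ≋-refl

  ∷-cong : ∀ {a b p p′} → a ≈ b → p ≋ p′ → (a ∷ p) ≋ (b ∷ p′)
  ∷-cong a≈b (mk≋ e) = mk≋ λ { zero → a≈b ; (suc i) → e i }

  coeff-+P : ∀ p p′ i → coeff (p +P p′) i ≈ coeff p i + coeff p′ i
  coeff-+P []      p′       i       = sym (+-identityˡ _)
  coeff-+P (a ∷ p) []       i       = sym (+-identityʳ _)
  coeff-+P (a ∷ p) (b ∷ p′) zero    = refl
  coeff-+P (a ∷ p) (b ∷ p′) (suc i) = coeff-+P p p′ i

  coeff-scale : ∀ a p i → coeff (map (a *_) p) i ≈ a * coeff p i
  coeff-scale a []      i       = sym (zeroʳ a)
  coeff-scale a (b ∷ p) zero    = refl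
  coeff-scale a (b ∷ p) (suc i) = coeff-scale a p i

  +P-cong : ∀ {p p′ q q′} → p ≋ p′ → q ≋ q′ → (p +P q) ≋ (p′ +P q′)
  +P-cong {p} {p′} {q} {q′} (mk≋ e) (mk≋ f) = mk≋ λ i → begin
    coeff (p +P q) i          ≈⟨ coeff-+P p q i ⟩
    coeff p i + coeff q i     ≈⟨ +-cong (e i) (f i) ⟩
    coeff p′ i + coeff q′ i   ≈⟨ coeff-+P p′ q′ i ⟨
    coeff (p′ +P q′) i        ∎
    where open SetoidReasoning setoid

  +P-comm : ∀ p q → (p +P q) ≋ (q +P p)
  +P-comm p q = mk≋ λ i → begin
    coeff (p +P q) i          ≈⟨ coeff-+P p q i ⟩
    coeff p i + coeff q i     ≈⟨ +-comm _ _ ⟩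
    coeff q i + coeff p i     ≈⟨ coeff-+P q p i ⟨
    coeff (q +P p) i          ∎
    where open SetoidReasoning setoid

  +P-assoc : ∀ p q s → ((p +P q) +P s) ≋ (p +P (q +P s))
  +P-assoc p q s = mk≋ λ i → begin
    coeff ((p +P q) +P s) i                 ≈⟨ trans (coeff-+P (p +P q) s i) (+-congʳ (coeff-+P p q i)) ⟩
    (coeff p i + coeff q i) + coeff s i     ≈⟨ +-assoc _ _ _ ⟩
    coeff p i + (coeff q i + coeff s i)     ≈⟨ trans (coeff-+P p (q +P s) i) (+-congˡ (coeff-+P q s i)) ⟨
    coeff (p +P (q +P s)) i                 ∎
    where open SetoidReasoning setoid

  +P-identityʳ : ∀ p → (p +P []) ≋ p
  +P-identityʳ []      = ≋-refl
  +P-identityʳ (a ∷ p) = ≋-refl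

  +P-commutativeSemigroup : CommutativeSemigroup c ℓ
  +P-commutativeSemigroup = record
    { Carrier = Poly ; _≈_ = _≋_ ; _∙_ = _+P_
    ; isCommutativeSemigroup = record
      { isSemigroup = record
        { isMagma = record { isEquivalence = Setoid.isEquivalence ≋-setoid ; ∙-cong = +P-cong }
        ; assoc = +P-assoc }
      ; comm = +P-comm } }

  module +P-Properties = CommutativeSemigroupProperties +P-commutativeSemigroup

  scale-cong : ∀ {a b p p′} → a ≈ b → p ≋ p′ → map (a *_) p ≋ map (b *_) p′
  scale-cong {a} {b} {p} {p′} a≈b (mk≋ e) = mk≋ λ i →
    trans (coeff-scale a p i) (trans (*-cong a≈b (e i)) (sym (coeff-scale b p′ i)))

  scale-zero : ∀ p → map (0# *_) p ≋ []
  scale-zero p = mk≋ λ i → trans (coeff-scale 0# p i) (zeroˡ _)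

  scale-one : ∀ p → map (1# *_) p ≋ p
  scale-one p = mk≋ λ i → trans (coeff-scale 1# p i) (*-identityˡ _)

  scale-distribʳ : ∀ a b p → map ((a + b) *_) p ≋ (map (a *_) p +P map (b *_) p)
  scale-distribʳ a b p = mk≋ λ i → trans (coeff-scale (a + b) p i) (trans (distribʳ _ a b)
    (sym (trans (coeff-+P (map (a *_) p) _ i) (+-cong (coeff-scale a p i) (coeff-scale b p i)))))

  scale-distribˡ : ∀ a p q → map (a *_) (p +P q) ≋ (map (a *_) p +P map (a *_) q)
  scale-distribˡ a p q = mk≋ λ i → trans (coeff-scale a (p +P q) i) (trans (*-congˡ (coeff-+P p q i))
    (trans (distribˡ a _ _) (sym (trans (coeff-+P (map (a *_) p) _ i) (+-cong (coeff-scale a p i) (coeff-scale a q i))))))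

  scale-scale : ∀ a b p → map (a *_) (map (b *_) p) ≋ map ((a * b) *_) p
  scale-scale a b p = mk≋ λ i → trans (coeff-scale a (map (b *_) p) i) (trans (*-congˡ (coeff-scale b p i))
    (trans (sym (*-assoc a b _)) (sym (coeff-scale (a * b) p i))))

  shift-+P : ∀ p q → (0# ∷ (p +P q)) ≋ ((0# ∷ p) +P (0# ∷ q))
  shift-+P p q = ∷-cong (sym (+-identityˡ 0#)) ≋-refl

  shift-scale : ∀ a p → map (a *_) (0# ∷ p) ≋ (0# ∷ map (a *_) p)
  shift-scale a p = ∷-cong (zeroʳ a) ≋-refl

  *P-congʳ : ∀ p {q q′} → q ≋ q′ → (p *P q) ≋ (p *P q′)
  *P-congʳ []      q≋q′ = ≋-refl
  *P-congʳ (a ∷ p) q≋q′ = +P-cong (scale-cong refl q≋q′) (∷-cong refl (*P-congʳ p q≋q′))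

  *P-zeroʳ : ∀ p → (p *P []) ≋ []
  *P-zeroʳ []      = ≋-refl
  *P-zeroʳ (a ∷ p) = ≋-trans (∷-cong refl (*P-zeroʳ p)) (mk≋ λ { zero → refl ; (suc i) → refl })

  *P-consʳ : ∀ p b q → (p *P (b ∷ q)) ≋ (map (b *_) p +P (0# ∷ (p *P q)))
  *P-consʳ []      b q = mk≋ λ { zero → refl ; (suc i) → refl }
  *P-consʳ (a ∷ p) b q = ∷-cong (+-congʳ (*-comm a b)) (begin
    map (a *_) q +P (p *P (b ∷ q))
      ≈⟨ +P-cong ≋-refl (*P-consʳ p b q) ⟩
    map (a *_) q +P (map (b *_) p +P (0# ∷ (p *P q)))
      ≈⟨ +P-Properties.x∙yz≈y∙xz (map (a *_) q) (map (b *_) p) (0# ∷ (p *P q)) ⟩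
    map (b *_) p +P (map (a *_) q +P (0# ∷ (p *P q)))   ∎)
    where open SetoidReasoning ≋-setoid

  *P-comm : ∀ p q → (p *P q) ≋ (q *P p)
  *P-comm []      q = ≋-sym (*P-zeroʳ q)
  *P-comm (a ∷ p) q = ≋-sym (≋-trans (*P-consʳ q a p) (+P-cong ≋-refl (∷-cong refl (*P-comm q p))))

  *P-cong : ∀ {p p′ q q′} → p ≋ p′ → q ≋ q′ → (p *P q) ≋ (p′ *P q′)
  *P-cong {p} {p′} {q} {q′} p≋p′ q≋q′ =
    ≋-trans (*P-comm p q) (≋-trans (*P-congʳ q p≋p′) (≋-trans (*P-comm q p′) (*P-congʳ p′ q≋q′)))

  *P-distribʳ : ∀ p q s → ((p +P q) *P s) ≋ ((p *P s) +P (q *P s))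
  *P-distribʳ []      q       s = ≋-refl
  *P-distribʳ (a ∷ p) []      s = ≋-sym (+P-identityʳ _)
  *P-distribʳ (a ∷ p) (b ∷ q) s = begin
    map ((a + b) *_) s +P (0# ∷ ((p +P q) *P s))
      ≈⟨ +P-cong (scale-distribʳ a b s) (≋-trans (∷-cong refl (*P-distribʳ p q s)) (shift-+P (p *P s) (q *P s))) ⟩
    (map (a *_) s +P map (b *_) s) +P ((0# ∷ (p *P s)) +P (0# ∷ (q *P s)))
      ≈⟨ +P-Properties.interchange (map (a *_) s) (map (b *_) s) (0# ∷ (p *P s)) (0# ∷ (q *P s)) ⟩
    (map (a *_) s +P (0# ∷ (p *P s))) +P (map (b *_) s +P (0# ∷ (q *P s)))   ∎
    where open SetoidReasoning ≋-setoid

  *P-scaleˡ : ∀ a p q → (map (a *_) p *P q) ≋ map (a *_) (p *P q)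
  *P-scaleˡ a []      q = ≋-refl
  *P-scaleˡ a (b ∷ p) q = begin
    map ((a * b) *_) q +P (0# ∷ (map (a *_) p *P q))
      ≈⟨ +P-cong (≋-sym (scale-scale a b q)) (∷-cong refl (*P-scaleˡ a p q)) ⟩
    map (a *_) (map (b *_) q) +P (0# ∷ map (a *_) (p *P q))
      ≈⟨ +P-cong ≋-refl (≋-sym (shift-scale a (p *P q))) ⟩
    map (a *_) (map (b *_) q) +P map (a *_) (0# ∷ (p *P q))
      ≈⟨ scale-distribˡ a (map (b *_) q) (0# ∷ (p *P q)) ⟨
    map (a *_) (map (b *_) q +P (0# ∷ (p *P q)))   ∎
    where open SetoidReasoning ≋-setoid

  *P-shiftˡ : ∀ p q → ((0# ∷ p) *P q) ≋ (0# ∷ (p *P q))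
  *P-shiftˡ p q = +P-cong (scale-zero q) ≋-refl

  *P-assoc : ∀ p q s → ((p *P q) *P s) ≋ (p *P (q *P s))
  *P-assoc []      q s = ≋-refl
  *P-assoc (a ∷ p) q s = ≋-trans (*P-distribʳ (map (a *_) q) (0# ∷ (p *P q)) s)
    (+P-cong (*P-scaleˡ a q s) (≋-trans (*P-shiftˡ (p *P q) s) (∷-cong refl (*P-assoc p q s))))

  *P-identityˡ : ∀ p → (1P *P p) ≋ p
  *P-identityˡ p = ≋-trans (+P-cong (scale-one p) (mk≋ λ { zero → refl ; (suc i) → refl }))
                           (+P-identityʳ p)

  *P-identityʳ : ∀ p → (p *P 1P) ≋ p
  *P-identityʳ p = ≋-trans (*P-comm p 1P) (*P-identityˡ p)

  mono-cong : ∀ {a b} n → a ≈ b → mono a n ≋ mono b n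
  mono-cong zero    a≈b = ∷-cong a≈b ≋-refl
  mono-cong (suc n) a≈b = ∷-cong refl (mono-cong n a≈b)

  coeff₀-*P : ∀ p q → coeff (p *P q) 0 ≈ coeff p 0 * coeff q 0
  coeff₀-*P []      q = sym (zeroˡ _)
  coeff₀-*P (a ∷ p) q = trans (coeff-+P (map (a *_) q) (0# ∷ (p *P q)) 0) (trans (+-identityʳ _) (coeff-scale a q 0))

  coeff₀≈1⇒≉0P : ∀ {p} → coeff p 0 ≈ 1# → ¬ (p ≈P 0P)
  coeff₀≈1⇒≉0P p₀≈1 p≈0 = 1≉0 (trans (sym p₀≈1) (p≈0 0))

  *P-commutativeMonoid : CommutativeMonoid c ℓ
  *P-commutativeMonoid = record
    { Carrier = Poly ; _≈_ = _≋_ ; _∙_ = _*P_ ; ε = 1P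
    ; isCommutativeMonoid = record
      { isMonoid = record
        { isSemigroup = record
          { isMagma = record { isEquivalence = Setoid.isEquivalence ≋-setoid ; ∙-cong = *P-cong }
          ; assoc = *P-assoc }
        ; identity = *P-identityˡ , *P-identityʳ }
      ; comm = *P-comm } }

  module *P-Properties = CommutativeSemigroupProperties (CommutativeMonoid.commutativeSemigroup *P-commutativeMonoid)

  *P-cross : ∀ {a a′ b b′} c → a′ ≋ (a *P c) → b′ ≋ (b *P c) → (a′ *P b) ≋ (a *P b′)
  *P-cross {a} {a′} {b} {b′} c a′≋ac b′≋bc = begin
    a′ *P b          ≈⟨ *P-cong a′≋ac ≋-refl ⟩
    (a *P c) *P b    ≈⟨ *P-Properties.xy∙z≈x∙zy a c b ⟩
    a *P (b *P c)    ≈⟨ *P-congʳ a b′≋bc ⟨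
    a *P b′          ∎
    where open SetoidReasoning ≋-setoid

module Products {c ℓ} (K : Field c ℓ) where
  open Nat using (_+_)
  open Field K using (_≈_; _*_; 1#; refl; trans; *-cong; *-identityˡ)
  open FieldOps K
  open Pieri K using (∏P)
  open PolynomialAlgebra K

  Π : ℕ → (ℕ → Poly) → Poly
  Π n f = ∏P (applyUpTo f n)

  Π-cong : ∀ n {f g : ℕ → Poly} → (∀ j → j < n → f j ≋ g j) → Π n f ≋ Π n g
  Π-cong zero    f≋g = ≋-refl
  Π-cong (suc n) f≋g = *P-cong (f≋g 0 (s≤s z≤n)) (Π-cong n λ j j<n → f≋g (suc j) (s≤s j<n))

  Π-≋1P : ∀ n {f : ℕ → Poly} → (∀ j → j < n → f j ≋ 1P) → Π n f ≋ 1P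
  Π-≋1P zero    f≋1 = ≋-refl
  Π-≋1P (suc n) f≋1 = ≋-trans (*P-cong (f≋1 0 (s≤s z≤n)) (Π-≋1P n λ j j<n → f≋1 (suc j) (s≤s j<n)))
                               (*P-identityˡ 1P)

  Π-*P : ∀ n (f g : ℕ → Poly) → Π n (λ j → f j *P g j) ≋ (Π n f *P Π n g)
  Π-*P zero    f g = ≋-sym (*P-identityˡ 1P)
  Π-*P (suc n) f g = ≋-trans (*P-congʳ (f 0 *P g 0) (Π-*P n (λ j → f (suc j)) (λ j → g (suc j))))
                             (*P-Properties.interchange (f 0) (g 0) _ _)

  Π-+ : ∀ m n (f : ℕ → Poly) → Π (m + n) f ≋ (Π m f *P Π n (λ j → f (m + j)))
  Π-+ zero    n f = ≋-sym (*P-identityˡ _)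
  Π-+ (suc m) n f = ≋-trans (*P-congʳ (f 0) (Π-+ m n (λ j → f (suc j))))
                            (≋-sym (*P-assoc (f 0) _ _))

  Π-prefix : ∀ {m n} {f : ℕ → Poly} → m ≤ n → (∀ j → m ≤ j → j < n → f j ≋ 1P) → Π n f ≋ Π m f
  Π-prefix {m} {n} {f} m≤n f≋1 = begin
    Π n f                                 ≡⟨ ≡.cong (λ n → Π n f) (m+[n∸m]≡n m≤n) ⟨
    Π (m + (n ∸ m)) f                     ≈⟨ Π-+ m (n ∸ m) f ⟩
    Π m f *P Π (n ∸ m) (λ j → f (m + j))  ≈⟨ *P-congʳ (Π m f) (Π-≋1P (n ∸ m) λ j j<n∸m →
                                               f≋1 (m + j) (m≤m+n m j) (m+j<n j<n∸m)) ⟩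
    Π m f *P 1P                           ≈⟨ *P-identityʳ (Π m f) ⟩
    Π m f                                 ∎
    where
    open SetoidReasoning ≋-setoid
    m+j<n : ∀ {j} → j < n ∸ m → m + j < n
    m+j<n j<n∸m = <-≤-trans (+-monoʳ-< m j<n∸m) (≤-reflexive (m+[n∸m]≡n m≤n))

  ∏P-++ : ∀ ps qs → ∏P (ps ++ qs) ≋ (∏P ps *P ∏P qs)
  ∏P-++ []       qs = ≋-sym (*P-identityˡ _)
  ∏P-++ (p ∷ ps) qs = ≋-trans (*P-congʳ p (∏P-++ ps qs)) (≋-sym (*P-assoc p (∏P ps) (∏P qs)))

  coeff₀-Π : ∀ n {f : ℕ → Poly} → (∀ j → j < n → coeff (f j) 0 ≈ 1#) → coeff (Π n f) 0 ≈ 1#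
  coeff₀-Π zero    f₀≈1 = refl
  coeff₀-Π (suc n) {f} f₀≈1 = trans (coeff₀-*P (f 0) (Π n (λ j → f (suc j))))
    (trans (*-cong (f₀≈1 0 (s≤s z≤n)) (coeff₀-Π n {λ j → f (suc j)} λ j j<n → f₀≈1 (suc j) (s≤s j<n)))
           (*-identityˡ 1#))

  cellProduct : List ℕ → (ℕ → ℕ → Poly) → Poly
  cellProduct []      F = 1P
  cellProduct (n ∷ ν) F = Π n (F 0) *P cellProduct ν (λ i → F (suc i))

  cellProduct-cong : ∀ ν {F G : ℕ → ℕ → Poly} → (∀ i j → j < part ν i → F i j ≋ G i j) →
                     cellProduct ν F ≋ cellProduct ν G
  cellProduct-cong []      F≋G = ≋-refl
  cellProduct-cong (n ∷ ν) F≋G = *P-cong (Π-cong n (F≋G 0)) (cellProduct-cong ν (λ i → F≋G (suc i)))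

  ∏P-map-cells : ∀ ν (F : ℕ × ℕ → Poly) → ∏P (map F (cells ν)) ≋ cellProduct ν (curry F)
  ∏P-map-cells = rows (λ i → i)
    where
    rowCells : ℕ → ℕ → List (ℕ × ℕ)
    rowCells i n = map (λ j → (i , j)) (upTo n)

    row : ∀ i n (F : ℕ × ℕ → Poly) → ∏P (map F (rowCells i n)) ≡ Π n (λ j → F (i , j))
    row i n F = ≡.cong ∏P (≡.trans (≡.sym (map-∘ (upTo n))) (map-upTo _ n))

    -- Generalised over the row labels g, which shift in the recursion; cells ν is the case g = id.
    rows : ∀ (g : ℕ → ℕ) ν (F : ℕ × ℕ → Poly) →
           ∏P (map F (concat (zipWith rowCells (applyUpTo g (length ν)) ν))) ≋ cellProduct ν (λ i j → F (g i , j))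
    rows g []      F = ≋-refl
    rows g (n ∷ ν) F = begin
      ∏P (map F (rowCells (g 0) n ++ rest))             ≡⟨ ≡.cong ∏P (map-++ F (rowCells (g 0) n) rest) ⟩
      ∏P (map F (rowCells (g 0) n) ++ map F rest)       ≈⟨ ∏P-++ (map F (rowCells (g 0) n)) (map F rest) ⟩
      ∏P (map F (rowCells (g 0) n)) *P ∏P (map F rest)  ≈⟨ *P-cong (≡⇒≋ (row (g 0) n F)) (rows (λ i → g (suc i)) ν F) ⟩
      cellProduct (n ∷ ν) (λ i j → F (g i , j))         ∎
      where
      open SetoidReasoning ≋-setoid
      rest : List (ℕ × ℕ)
      rest = concat (zipWith rowCells (applyUpTo (λ i → g (suc i)) (length ν)) ν)

-- Conjugate partitions and interlacing sequences

conj-∷-< : ∀ {x j} ν → j < x → conj (x ∷ ν) j ≡ suc (conj ν j)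
conj-∷-< {j = j} ν j<x = ≡.cong length (filter-accept (j <?_) {xs = ν} j<x)

conj-∷-≮ : ∀ {x j} ν → ¬ j < x → conj (x ∷ ν) j ≡ conj ν j
conj-∷-≮ {j = j} ν j≮x = ≡.cong length (filter-reject (j <?_) {xs = ν} j≮x)

conj-≤-∷ : ∀ x ν j → conj ν j ≤ conj (x ∷ ν) j
conj-≤-∷ x ν j with j <? x
... | yes j<x = ≤-trans (n≤1+n _) (≤-reflexive (≡.sym (conj-∷-< ν j<x)))
... | no  j≮x = ≤-reflexive (≡.sym (conj-∷-≮ ν j≮x))

conj-≡0 : ∀ {j} ν → All (_≤ j) ν → conj ν j ≡ 0
conj-≡0 []      []           = ≡.refl
conj-≡0 (x ∷ ν) (x≤j ∷ ν≤j) = ≡.trans (conj-∷-≮ ν (λ j<x → <⇒≱ j<x x≤j)) (conj-≡0 ν ν≤j)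

conj-↭ : ∀ {ν ν′} → ν ↭ ν′ → ∀ j → conj ν j ≡ conj ν′ j
conj-↭ ν↭ν′ j = ↭-length (filter-↭ (j <?_) ν↭ν′)

data Interlacing : List ℕ → List ℕ → Set where
  nil    : Interlacing [] []
  single : ∀ x → Interlacing (x ∷ []) []
  cons   : ∀ {x y λ′ μ} → y ≤ x → part λ′ 0 ≤ y → Interlacing λ′ μ → Interlacing (x ∷ λ′) (y ∷ μ)

Interlacing-conj : ∀ {λ′ μ} → Interlacing λ′ μ → ∀ j → conj μ j ≤ conj λ′ j
Interlacing-conj nil         j = z≤n
Interlacing-conj (single x)  j = z≤n
Interlacing-conj {x ∷ λ′} {y ∷ μ} (cons y≤x _ il) j with j <? y
... | yes j<y rewrite conj-∷-< μ j<y | conj-∷-< λ′ (<-≤-trans j<y y≤x) = s≤s (Interlacing-conj il j)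
... | no  j≮y rewrite conj-∷-≮ μ j≮y = ≤-trans (Interlacing-conj il j) (conj-≤-∷ x λ′ j)

Interlacing-part : ∀ {λ′ μ} → Interlacing λ′ μ → ∀ i → part μ i ≤ part λ′ 0
Interlacing-part nil                    i       = z≤n
Interlacing-part (single x)             i       = z≤n
Interlacing-part (cons y≤x λ′₀≤y il) zero    = y≤x
Interlacing-part (cons y≤x λ′₀≤y il) (suc i) = ≤-trans (Interlacing-part il i) (≤-trans λ′₀≤y y≤x)

HorizontalStrip-tail : ∀ {x y λ′ μ} → y ≤ x → HorizontalStrip (x ∷ λ′) (y ∷ μ) → HorizontalStrip λ′ μ
HorizontalStrip-tail {x} {y} {λ′} {μ} y≤x strip j with j <? y
... | yes j<y = s≤s⁻¹ (≡.subst₂ (λ a b → a ≤ suc b)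
                  (conj-∷-< λ′ (<-≤-trans j<y y≤x)) (conj-∷-< μ j<y) (strip j))
... | no  j≮y = ≤-trans (conj-≤-∷ x λ′ j) (≡.subst (λ b → conj (x ∷ λ′) j ≤ suc b) (conj-∷-≮ μ j≮y) (strip j))

IsPartition-tail : ∀ {x ν} → IsPartition (x ∷ ν) → IsPartition ν
IsPartition-tail (dec , pos) = Linked.tail dec , All.tail pos

conj-∷-∷-< : ∀ {x z j} ν → j < z → z ≤ x → conj (x ∷ z ∷ ν) j ≡ suc (suc (conj ν j))
conj-∷-∷-< ν j<z z≤x = ≡.trans (conj-∷-< (_ ∷ ν) (<-≤-trans j<z z≤x)) (≡.cong suc (conj-∷-< ν j<z))

2+n≰1 : ∀ {n} → ¬ suc (suc n) ≤ 1
2+n≰1 (s≤s ())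

-- Otherwise column y would contain a cell of λ′ in each of rows 0 and 1 but no cell of μ.
HorizontalStrip-head : ∀ {x y λ′ μ} → Linked _≥_ (x ∷ λ′) → Linked _≥_ (y ∷ μ) →
                       HorizontalStrip (x ∷ λ′) (y ∷ μ) → part λ′ 0 ≤ y
HorizontalStrip-head {λ′ = []}               _         _    _     = z≤n
HorizontalStrip-head {x} {y} {z ∷ λ′} {μ} (z≤x ∷ _) decμ strip with z ≤? y
... | yes z≤y = z≤y
... | no  z≰y = ⊥-elim (2+n≰1 (≡.subst₂ _≤_ (conj-∷-∷-< λ′ (≰⇒> z≰y) z≤x) (≡.cong suc conj-μ) (strip y)))
  where
  ≥-trans : ∀ {i j k} → j ≤ i → k ≤ j → k ≤ i
  ≥-trans j≤i k≤j = ≤-trans k≤j j≤i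
  conj-μ : conj (y ∷ μ) y ≡ 0
  conj-μ = ≡.trans (conj-∷-≮ μ (<-irrefl ≡.refl)) (conj-≡0 μ (All.tail (Linked⇒All ≥-trans ≤-refl decμ)))

HorizontalStrip⇒Interlacing : ∀ {λ′ μ} → IsPartition λ′ → IsPartition μ → μ ⊆ₚ λ′ →
                              HorizontalStrip λ′ μ → Interlacing λ′ μ
HorizontalStrip⇒Interlacing {[]}              {[]}    _ _ _ _ = nil
HorizontalStrip⇒Interlacing {x ∷ []}          {[]}    _ _ _ _ = single x
HorizontalStrip⇒Interlacing {x ∷ z ∷ λ′}      {[]}    (z≤x ∷ _ , _ ∷ 0<z ∷ _) _ _ strip =
  ⊥-elim (2+n≰1 (≡.subst (_≤ 1) (conj-∷-∷-< λ′ 0<z z≤x) (strip 0)))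
HorizontalStrip⇒Interlacing {[]}              {y ∷ μ} _ (_ , 0<y ∷ _) μ⊆λ′ _ with ≤-trans 0<y (μ⊆λ′ 0)
... | ()
HorizontalStrip⇒Interlacing {x ∷ λ′}          {y ∷ μ} pλ′ pμ μ⊆λ′ strip =
  cons y≤x (HorizontalStrip-head (proj₁ pλ′) (proj₁ pμ) strip)
    (HorizontalStrip⇒Interlacing (IsPartition-tail pλ′) (IsPartition-tail pμ) (λ i → μ⊆λ′ (suc i))
                                 (HorizontalStrip-tail y≤x strip))
  where
  y≤x : y ≤ x
  y≤x = μ⊆λ′ 0

Interlacing-raise : ∀ {x z λ′ μ} → z ≤ x → Interlacing (z ∷ λ′) μ → Interlacing (x ∷ λ′) μ
Interlacing-raise z≤x (single z)          = single _
Interlacing-raise z≤x (cons y≤z λ′₀≤y il) = cons (≤-trans y≤z z≤x) λ′₀≤y il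

module Insertion (r : ℕ) where
  open Nat using (_+_)

  conj-replicate-++-< : ∀ {j} n ν → j < r → conj (replicate n r ++ ν) j ≡ n + conj ν j
  conj-replicate-++-< zero    ν j<r = ≡.refl
  conj-replicate-++-< (suc n) ν j<r = ≡.trans (conj-∷-< (replicate n r ++ ν) j<r) (≡.cong suc (conj-replicate-++-< n ν j<r))

  conj-replicate-++-≮ : ∀ {j} n ν → ¬ j < r → conj (replicate n r ++ ν) j ≡ conj ν j
  conj-replicate-++-≮ zero    ν j≮r = ≡.refl
  conj-replicate-++-≮ (suc n) ν j≮r = ≡.trans (conj-∷-≮ (replicate n r ++ ν) j≮r) (conj-replicate-++-≮ n ν j≮r)

  insertPart-↭ : ∀ ν → insertPart r ν ↭ r ∷ ν
  insertPart-↭ []      = ↭-refl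
  insertPart-↭ (x ∷ ν) with x <ᵇ r
  ... | true  = ↭-refl
  ... | false = ↭-trans (prep x (insertPart-↭ ν)) (swap x r ↭-refl)

  ∪-↭ : ∀ ν n → ν ∪ r ^ n ↭ replicate n r ++ ν
  ∪-↭ ν zero    = ↭-refl
  ∪-↭ ν (suc n) = ↭-trans (insertPart-↭ (ν ∪ r ^ n)) (prep r (∪-↭ ν n))

  conj-∪ : ∀ ν n j → conj (ν ∪ r ^ n) j ≡ conj (replicate n r ++ ν) j
  conj-∪ ν n = conj-↭ (∪-↭ ν n)

  insertPart-∷ : ∀ {x} ν → r ≤ x → insertPart r (x ∷ ν) ≡ x ∷ insertPart r ν
  insertPart-∷ {x} ν r≤x =
    ≡.cong (λ b → if b then r ∷ x ∷ ν else x ∷ insertPart r ν) (dec-false (x <? r) (≤⇒≯ r≤x))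

  ∪-∷ : ∀ {x} ν n → r ≤ x → (x ∷ ν) ∪ r ^ n ≡ x ∷ (ν ∪ r ^ n)
  ∪-∷ ν zero    r≤x = ≡.refl
  ∪-∷ ν (suc n) r≤x = ≡.trans (≡.cong (insertPart r) (∪-∷ ν n r≤x)) (insertPart-∷ (ν ∪ r ^ n) r≤x)

  insertPart-replicate-++ : ∀ n ν → part ν 0 < r → insertPart r (replicate n r ++ ν) ≡ replicate (suc n) r ++ ν
  insertPart-replicate-++ zero    []      _   = ≡.refl
  insertPart-replicate-++ zero    (x ∷ ν) x<r =
    ≡.cong (λ b → if b then r ∷ x ∷ ν else x ∷ insertPart r ν) (dec-true (x <? r) x<r)
  insertPart-replicate-++ (suc n) ν       ν₀<r =
    ≡.trans (insertPart-∷ (replicate n r ++ ν) ≤-refl) (≡.cong (r ∷_) (insertPart-replicate-++ n ν ν₀<r))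

  ∪-< : ∀ ν n → part ν 0 < r → ν ∪ r ^ n ≡ replicate n r ++ ν
  ∪-< ν zero    ν₀<r = ≡.refl
  ∪-< ν (suc n) ν₀<r = ≡.trans (≡.cong (insertPart r) (∪-< ν n ν₀<r)) (insertPart-replicate-++ n ν ν₀<r)

  part₀-insertPart : ∀ {y} ν → part ν 0 ≤ y → r ≤ y → part (insertPart r ν) 0 ≤ y
  part₀-insertPart []      ν₀≤y r≤y = r≤y
  part₀-insertPart (x ∷ ν) x≤y r≤y with x <ᵇ r
  ... | true  = r≤y
  ... | false = x≤y

  part₀-∪ : ∀ {y} ν n → part ν 0 ≤ y → r ≤ y → part (ν ∪ r ^ n) 0 ≤ y
  part₀-∪ ν zero    ν₀≤y r≤y = ν₀≤y
  part₀-∪ ν (suc n) ν₀≤y r≤y = part₀-insertPart (ν ∪ r ^ n) (part₀-∪ ν n ν₀≤y r≤y) r≤y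

  part₀-replicate-++ : ∀ n ν → part ν 0 ≤ r → part (replicate n r ++ ν) 0 ≤ r
  part₀-replicate-++ zero    ν ν₀≤r = ν₀≤r
  part₀-replicate-++ (suc n) ν ν₀≤r = ≤-refl

  Interlacing-replicate : ∀ {λ′ μ} n → part λ′ 0 ≤ r → Interlacing λ′ μ →
                          Interlacing (replicate n r ++ λ′) (replicate n r ++ μ)
  Interlacing-replicate zero    λ′₀≤r il = il
  Interlacing-replicate (suc n) λ′₀≤r il =
    cons ≤-refl (part₀-replicate-++ n _ λ′₀≤r) (Interlacing-replicate n λ′₀≤r il)

  ∪-between : ∀ {x} ν n → r ≤ x → part ν 0 < r → (x ∷ ν) ∪ r ^ n ≡ x ∷ (replicate n r ++ ν)
  ∪-between ν n r≤x ν₀<r = ≡.trans (∪-∷ ν n r≤x) (≡.cong (_ ∷_) (∪-< ν n ν₀<r))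

  Interlacing-between : ∀ {x λ′ μ} n → r ≤ x → Interlacing (r ∷ λ′) μ →
                        Interlacing (x ∷ (replicate n r ++ λ′)) (replicate n r ++ μ)
  Interlacing-between zero    r≤x il = Interlacing-raise r≤x il
  Interlacing-between (suc n) r≤x il =
    cons r≤x ≤-refl (Interlacing-between n ≤-refl il)

  Interlacing-∪ : ∀ {λ′ μ} → 0 < r → Interlacing λ′ μ → ∀ n → Interlacing (λ′ ∪ r ^ n) (μ ∪ r ^ n)
  Interlacing-∪ 0<r nil n = ≡.subst₂ Interlacing (≡.sym (∪-< [] n 0<r)) (≡.sym (∪-< [] n 0<r))
    (Interlacing-replicate n z≤n nil)
  Interlacing-∪ 0<r (single x) n with x <? r
  ... | yes x<r = ≡.subst₂ Interlacing (≡.sym (∪-< (x ∷ []) n x<r)) (≡.sym (∪-< [] n 0<r))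
    (Interlacing-replicate n (<⇒≤ x<r) (single x))
  ... | no  x≮r = ≡.subst₂ Interlacing (≡.sym (∪-between [] n (≮⇒≥ x≮r) 0<r)) (≡.sym (∪-< [] n 0<r))
    (Interlacing-between n (≮⇒≥ x≮r) (single r))
  Interlacing-∪ {x ∷ λ′} {y ∷ μ} 0<r (cons y≤x λ′₀≤y il) n with y <? r | x <? r
  ... | no y≮r | _ = ≡.subst₂ Interlacing (≡.sym (∪-∷ λ′ n (≤-trans r≤y y≤x))) (≡.sym (∪-∷ μ n r≤y))
    (cons y≤x (part₀-∪ λ′ n λ′₀≤y r≤y) (Interlacing-∪ 0<r il n))
    where
    r≤y : r ≤ y
    r≤y = ≮⇒≥ y≮r
  ... | yes y<r | yes x<r = ≡.subst₂ Interlacing (≡.sym (∪-< (x ∷ λ′) n x<r)) (≡.sym (∪-< (y ∷ μ) n y<r))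
    (Interlacing-replicate n (<⇒≤ x<r) (cons y≤x λ′₀≤y il))
  ... | yes y<r | no x≮r = ≡.subst₂ Interlacing (≡.sym (∪-between λ′ n (≮⇒≥ x≮r) (≤-<-trans λ′₀≤y y<r)))
    (≡.sym (∪-< (y ∷ μ) n y<r)) (Interlacing-between n (≮⇒≥ x≮r) (cons (<⇒≤ y<r) λ′₀≤y il))

-- ψ row by row

module RowForm {c ℓ} (K : Field c ℓ) (U V : ℕ → ℕ → FieldOps.Poly K) where
  open FieldOps K
  open Pieri K using (inRnotC; ∏P)
  open PolynomialAlgebra K
  open Products K

  ψFactor : List ℕ → List ℕ → ℕ × ℕ → Poly
  ψFactor λ′ μ s = if inRnotC λ′ μ s then U (arm μ s) (leg μ s) *P V (arm λ′ s) (leg λ′ s) else 1P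

  -- The factor of the cell in column j of a row pair (x, y) = (λᵢ, μᵢ) of interlacing λ′, μ, where
  -- a, b count the cells of λ′, μ in column j below row i: these are the legs, and the test
  -- conj λ′ j ≟ conj μ j of inRnotC becomes a ≟ b.
  cellFactor : (x y j a b : ℕ) → Poly
  cellFactor x y j a b = if does (y <? x) ∧ does (a ≟ b) then U (y ∸ j ∸ 1) b *P V (x ∸ j ∸ 1) a else 1P

  ψRows : List ℕ → List ℕ → Poly
  ψRows λ′       []      = 1P
  ψRows []       (y ∷ μ) = 1P
  ψRows (x ∷ λ′) (y ∷ μ) = Π y (λ j → cellFactor x y j (conj λ′ j) (conj μ j)) *P ψRows λ′ μ

  ψRows-≡ : ∀ {Λ Λ′ M M′} → Λ ≡ Λ′ → M ≡ M′ → ψRows Λ M ≋ ψRows Λ′ M′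
  ψRows-≡ Λ≡Λ′ M≡M′ = ≡⇒≋ (≡.cong₂ ψRows Λ≡Λ′ M≡M′)

  cellFactor-≢ : ∀ x y j {a b} → a ≢ b → cellFactor x y j a b ≡ 1P
  cellFactor-≢ x y j {a} {b} a≢b = ≡.trans
    (≡.cong (λ t → if does (y <? x) ∧ t then U (y ∸ j ∸ 1) b *P V (x ∸ j ∸ 1) a else 1P) (dec-false (a ≟ b) a≢b))
    (≡.cong (λ t → if t then U (y ∸ j ∸ 1) b *P V (x ∸ j ∸ 1) a else 1P) (∧-zeroʳ (does (y <? x))))

  cellFactor-diag : ∀ x j a b → cellFactor x x j a b ≡ 1P
  cellFactor-diag x j a b = ≡.cong (λ t → if t ∧ does (a ≟ b) then U (x ∸ j ∸ 1) b *P V (x ∸ j ∸ 1) a else 1P)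
                                   (dec-false (x <? x) (<-irrefl ≡.refl))

  cellFactor-< : ∀ {x y} j a → y < x → cellFactor x y j a a ≡ U (y ∸ j ∸ 1) a *P V (x ∸ j ∸ 1) a
  cellFactor-< {x} {y} j a y<x = ≡.cong₂ (λ s t → if s ∧ t then U (y ∸ j ∸ 1) a *P V (x ∸ j ∸ 1) a else 1P)
                                         (dec-true (y <? x) y<x) (dec-true (a ≟ a) ≡.refl)

  ψRows-replicate : ∀ r n λ′ μ → ψRows (replicate n r ++ λ′) (replicate n r ++ μ) ≋ ψRows λ′ μ
  ψRows-replicate r zero    λ′ μ = ≋-refl
  ψRows-replicate r (suc n) λ′ μ =
    ≋-trans (*P-cong (Π-≋1P r (λ j _ → ≡⇒≋ (cellFactor-diag r j _ _))) (ψRows-replicate r n λ′ μ)) (*P-identityˡ _)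

  cellProduct-ψFactor : ∀ {λ′ μ} → Interlacing λ′ μ → cellProduct μ (curry (ψFactor λ′ μ)) ≋ ψRows λ′ μ
  cellProduct-ψFactor nil        = ≋-refl
  cellProduct-ψFactor (single x) = ≋-refl
  cellProduct-ψFactor {x ∷ λ′} {y ∷ μ} (cons y≤x λ′₀≤y il) =
    *P-cong (Π-cong y λ j j<y → ≡⇒≋ (row-shift 0 j<y))
            (≋-trans (cellProduct-cong μ λ i j j<μᵢ → ≡⇒≋ (row-shift (suc i) (column-bound i j<μᵢ)))
                     (cellProduct-ψFactor il))
    where
    column-bound : ∀ i {j} → j < part μ i → j < y
    column-bound i j<μᵢ = <-≤-trans j<μᵢ (≤-trans (Interlacing-part il i) λ′₀≤y)

    -- row 0 j (suc a) (suc b) and row (suc i) j (suc a) (suc b) reduce to cellFactor x y j a b and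
    -- ψFactor λ′ μ (i , j) when a, b are the column lengths of λ′, μ.
    row : ℕ → ℕ → ℕ → ℕ → Poly
    row i j a b = if does (part (y ∷ μ) i <? part (x ∷ λ′) i) ∧ does (a ≟ b)
                  then U (part (y ∷ μ) i ∸ j ∸ 1) (b ∸ i ∸ 1) *P V (part (x ∷ λ′) i ∸ j ∸ 1) (a ∸ i ∸ 1) else 1P

    row-shift : ∀ i {j} → j < y → ψFactor (x ∷ λ′) (y ∷ μ) (i , j) ≡ row i j (suc (conj λ′ j)) (suc (conj μ j))
    row-shift i {j} j<y = ≡.cong₂ (row i j) (conj-∷-< λ′ (<-≤-trans j<y y≤x)) (conj-∷-< μ j<y)

  ∏P-ψFactor : ∀ {λ′ μ} → Interlacing λ′ μ → ∏P (map (ψFactor λ′ μ) (cells μ)) ≋ ψRows λ′ μ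
  ∏P-ψFactor {λ′} {μ} il = ≋-trans (∏P-map-cells μ (ψFactor λ′ μ)) (cellProduct-ψFactor il)

-- Inserting l parts r

replicate-suc-++ : ∀ {a} {A : Set a} n (x : A) xs → replicate (suc n) x ++ xs ≡ replicate n x ++ (x ∷ xs)
replicate-suc-++ zero    x xs = ≡.refl
replicate-suc-++ (suc n) x xs = ≡.cong (x ∷_) (replicate-suc-++ n x xs)

module StripInsertion {c ℓ} (K : Field c ℓ) (T : ℕ → ℕ → FieldOps.Poly K) (k r : ℕ) (0<r : 0 < r) where
  open FieldOps K
  open Pieri K using (∏P)
  open PolynomialAlgebra K
  open Products K
  open Insertion r
  open CommutativeMonoidSolver *P-commutativeMonoid using (solve; _⊕_; _⊜_)
  open Nat using (_+_)

  l : ℕ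
  l = suc k

  ≟-+ˡ : ∀ n a b → does (n + a ≟ n + b) ≡ does (a ≟ b)
  ≟-+ˡ zero    a b = ≡.refl
  ≟-+ˡ (suc n) a b = ≟-+ˡ n a b

  l+a≢k+b : ∀ {a b} → b ≤ a → l + a ≢ k + b
  l+a≢k+b b≤a l+a≡k+b = <-irrefl (≡.sym l+a≡k+b) (s≤s (+-monoʳ-≤ k b≤a))

  -- Inserting the rows splits the first pair (x, y) with y < r ≤ x; cellFactor-telescope below
  -- produces this factor, which involves the weights only through T.
  correctionFactor : (x j a b : ℕ) → Poly
  correctionFactor x j a b = if does (r <? x) ∧ does (a ≟ b) then T (r ∸ j ∸ 1) a else 1P

  correctionRow : ℕ → List ℕ → ℕ → List ℕ → Poly
  correctionRow x λ′ y μ = Π y (λ j → correctionFactor x j (conj λ′ j) (conj μ j))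

  correction : List ℕ → List ℕ → Poly
  correction (x ∷ λ′) (y ∷ μ) = if does (y <? r) then correctionRow x λ′ y μ else correction λ′ μ
  correction _        _       = 1P

  correction-< : ∀ {x y} λ′ μ → y < r → correction (x ∷ λ′) (y ∷ μ) ≡ correctionRow x λ′ y μ
  correction-< {x} {y} λ′ μ y<r =
    ≡.cong (λ t → if t then correctionRow x λ′ y μ else correction λ′ μ) (dec-true (y <? r) y<r)

  correction-≮ : ∀ {x y} λ′ μ → ¬ y < r → correction (x ∷ λ′) (y ∷ μ) ≡ correction λ′ μ
  correction-≮ {x} {y} λ′ μ y≮r =
    ≡.cong (λ t → if t then correctionRow x λ′ y μ else correction λ′ μ) (dec-false (y <? r) y≮r)

  correctionFactor-≯ : ∀ {x} j a b → ¬ r < x → correctionFactor x j a b ≡ 1P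
  correctionFactor-≯ {x} j a b r≮x =
    ≡.cong (λ t → if t ∧ does (a ≟ b) then T (r ∸ j ∸ 1) a else 1P) (dec-false (r <? x) r≮x)

  correctionFactor-≢ : ∀ x j {a b} → a ≢ b → correctionFactor x j a b ≡ 1P
  correctionFactor-≢ x j {a} {b} a≢b = ≡.trans
    (≡.cong (λ t → if does (r <? x) ∧ t then T (r ∸ j ∸ 1) a else 1P) (dec-false (a ≟ b) a≢b))
    (≡.cong (λ t → if t then T (r ∸ j ∸ 1) a else 1P) (∧-zeroʳ (does (r <? x))))

  correctionFactor-< : ∀ {x} j a → r < x → correctionFactor x j a a ≡ T (r ∸ j ∸ 1) a
  correctionFactor-< {x} j a r<x = ≡.cong₂ (λ s t → if s ∧ t then T (r ∸ j ∸ 1) a else 1P)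
                                         (dec-true (r <? x) r<x) (dec-true (a ≟ a) ≡.refl)

  module Weights (U V : ℕ → ℕ → Poly)
                 (U-periodic : ∀ A L → U A (l + L) ≋ U A L)
                 (V-periodic : ∀ A L → V A (l + L) ≋ V A L)
                 (UV≋T : ∀ A L → (U A L *P V A L) ≋ T A L) where
    open RowForm K U V

    cellFactor-periodic : ∀ x y j a b → cellFactor x y j (l + a) (l + b) ≋ cellFactor x y j a b
    cellFactor-periodic x y j a b = ≋-trans
      (≡⇒≋ (≡.cong (λ t → if does (y <? x) ∧ t then U (y ∸ j ∸ 1) (l + b) *P V (x ∸ j ∸ 1) (l + a) else 1P)
                   (≟-+ˡ l a b)))
      (if-cong (does (y <? x) ∧ does (a ≟ b)) (*P-cong (U-periodic (y ∸ j ∸ 1) b) (V-periodic (x ∸ j ∸ 1) a)))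

    cellFactor-telescope : ∀ {x y} j a b → y < r → r ≤ x →
                           (cellFactor r y j a b *P cellFactor x r j a b)
                             ≋ (cellFactor x y j a b *P correctionFactor x j a b)
    cellFactor-telescope {x} {y} j a b y<r r≤x with a ≟ b | r <? x
    ... | no a≢b     | _       =
      ≡⇒≋ (≡.cong₂ _*P_ (≡.trans (cellFactor-≢ r y j a≢b) (≡.sym (cellFactor-≢ x y j a≢b)))
                        (≡.trans (cellFactor-≢ x r j a≢b) (≡.sym (correctionFactor-≢ x j a≢b))))
    ... | yes ≡.refl | no r≮x rewrite ≡.sym (≤∧≮⇒≡ r≤x r≮x) =
      ≡⇒≋ (≡.cong (cellFactor r y j a a *P_)
                  (≡.trans (cellFactor-diag r j a a) (≡.sym (correctionFactor-≯ j a a (<-irrefl ≡.refl)))))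
    ... | yes ≡.refl | yes r<x = begin
      cellFactor r y j a a *P cellFactor x r j a a
        ≡⟨ ≡.cong₂ _*P_ (cellFactor-< j a y<r) (cellFactor-< j a r<x) ⟩
      (U y′ a *P V r′ a) *P (U r′ a *P V x′ a)
        ≈⟨ solve 4 (λ p q s t → (p ⊕ q) ⊕ (s ⊕ t) ⊜ (p ⊕ t) ⊕ (s ⊕ q)) ≋-refl (U y′ a) (V r′ a) (U r′ a) (V x′ a) ⟩
      (U y′ a *P V x′ a) *P (U r′ a *P V r′ a)
        ≈⟨ *P-congʳ (U y′ a *P V x′ a) (UV≋T r′ a) ⟩
      (U y′ a *P V x′ a) *P T r′ a
        ≡⟨ ≡.cong₂ _*P_ (cellFactor-< j a (<-≤-trans y<r r≤x)) (correctionFactor-< j a r<x) ⟨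
      cellFactor x y j a a *P correctionFactor x j a a
        ∎
      where
      open SetoidReasoning ≋-setoid
      x′ y′ r′ : ℕ
      x′ = x ∸ j ∸ 1
      y′ = y ∸ j ∸ 1
      r′ = r ∸ j ∸ 1

    cellFactor-∪ : ∀ x y j λ′ μ →
                   cellFactor x y j (conj (λ′ ∪ r ^ l) j) (conj (μ ∪ r ^ l) j) ≋ cellFactor x y j (conj λ′ j) (conj μ j)
    cellFactor-∪ x y j λ′ μ with j <? r
    ... | yes j<r = ≋-trans (≡⇒≋ (≡.cong₂ (cellFactor x y j) (≡.trans (conj-∪ λ′ l j) (conj-replicate-++-< l λ′ j<r))
                                                            (≡.trans (conj-∪ μ l j) (conj-replicate-++-< l μ j<r))))
                            (cellFactor-periodic x y j (conj λ′ j) (conj μ j))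
    ... | no  j≮r = ≡⇒≋ (≡.cong₂ (cellFactor x y j) (≡.trans (conj-∪ λ′ l j) (conj-replicate-++-≮ l λ′ j≮r))
                                                   (≡.trans (conj-∪ μ l j) (conj-replicate-++-≮ l μ j≮r)))

    ψRows-∪-front : ∀ {λ′ μ} → part μ 0 ≤ part λ′ 0 → part λ′ 0 < r →
                    ψRows (λ′ ∪ r ^ l) (μ ∪ r ^ l) ≋ ψRows λ′ μ
    ψRows-∪-front {λ′} {μ} μ₀≤λ′₀ λ′₀<r =
      ≋-trans (ψRows-≡ (∪-< λ′ l λ′₀<r) (∪-< μ l (≤-<-trans μ₀≤λ′₀ λ′₀<r))) (ψRows-replicate r l λ′ μ)

    ψRows-below-inserted : ∀ λ′ ν → ψRows (replicate l r ++ λ′) (replicate k r ++ ν) ≋ ψRows (r ∷ λ′) ν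
    ψRows-below-inserted λ′ ν =
      ≋-trans (≡⇒≋ (≡.cong (λ Λ → ψRows Λ (replicate k r ++ ν)) (replicate-suc-++ k r λ′)))
              (ψRows-replicate r k (r ∷ λ′) ν)

    cellFactor-inserted : ∀ x j λ′ ν → j < r →
                          cellFactor x r j (conj (replicate l r ++ λ′) j) (conj (replicate k r ++ ν) j)
                            ≡ cellFactor x r j (l + conj λ′ j) (k + conj ν j)
    cellFactor-inserted x j λ′ ν j<r =
      ≡.cong₂ (cellFactor x r j) (conj-replicate-++-< l λ′ j<r) (conj-replicate-++-< k ν j<r)

    ψRows-∪-between-single : ∀ {x} → r ≤ x → ψRows (x ∷ (replicate l r ++ [])) (replicate l r ++ []) ≋ 1P
    ψRows-∪-between-single {x} r≤x = ≋-trans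
      (*P-cong (Π-≋1P r λ j j<r → ≡⇒≋ (≡.trans (cellFactor-inserted x j [] [] j<r) (cellFactor-≢ x r j (l+a≢k+b z≤n))))
               (ψRows-below-inserted [] []))
      (*P-identityˡ 1P)

    ψRows-∪-between : ∀ {x y λ′ μ} → y < r → r ≤ x → Interlacing λ′ μ →
                      ψRows (x ∷ (replicate l r ++ λ′)) (replicate l r ++ (y ∷ μ))
                        ≋ (ψRows (x ∷ λ′) (y ∷ μ) *P correctionRow x λ′ y μ)
    ψRows-∪-between {x} {y} {λ′} {μ} y<r r≤x il = begin
      Π r F *P ψRows (replicate l r ++ λ′) (replicate k r ++ (y ∷ μ))
        ≈⟨ *P-cong top-row (ψRows-below-inserted λ′ (y ∷ μ)) ⟩
      Π y A *P (Π y B *P R)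
        ≈⟨ solve 3 (λ a b ρ → a ⊕ (b ⊕ ρ) ⊜ (b ⊕ a) ⊕ ρ) ≋-refl (Π y A) (Π y B) R ⟩
      (Π y B *P Π y A) *P R
        ≈⟨ *P-cong (Π-*P y B A) ≋-refl ⟨
      Π y (λ j → B j *P A j) *P R
        ≈⟨ *P-cong (Π-cong y λ j j<y → cellFactor-telescope j (conj λ′ j) (conj μ j) y<r r≤x) ≋-refl ⟩
      Π y (λ j → C j *P D j) *P R
        ≈⟨ *P-cong (Π-*P y C D) ≋-refl ⟩
      (Π y C *P Π y D) *P R
        ≈⟨ solve 3 (λ c d ρ → (c ⊕ d) ⊕ ρ ⊜ (c ⊕ ρ) ⊕ d) ≋-refl (Π y C) (Π y D) R ⟩
      (Π y C *P R) *P Π y D   ∎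
      where
      open SetoidReasoning ≋-setoid
      F A B C D : ℕ → Poly
      F j = cellFactor x r j (conj (replicate l r ++ λ′) j) (conj (replicate k r ++ (y ∷ μ)) j)
      A j = cellFactor x r j (conj λ′ j) (conj μ j)
      B j = cellFactor r y j (conj λ′ j) (conj μ j)
      C j = cellFactor x y j (conj λ′ j) (conj μ j)
      D j = correctionFactor x j (conj λ′ j) (conj μ j)
      R : Poly
      R = ψRows λ′ μ

      top-row : Π r F ≋ Π y A
      top-row = ≋-trans (Π-prefix (<⇒≤ y<r) upper) (Π-cong y lower)
        where
        -- Beyond column y the legs of row (x, r) are l + a and k + b with b ≤ a, so they never agree.
        upper : ∀ j → y ≤ j → j < r → F j ≋ 1P
        upper j y≤j j<r = ≡⇒≋ (≡.trans (cellFactor-inserted x j λ′ (y ∷ μ) j<r)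
          (≡.trans (≡.cong (λ b → cellFactor x r j (l + conj λ′ j) (k + b)) (conj-∷-≮ μ (≤⇒≯ y≤j)))
                   (cellFactor-≢ x r j (l+a≢k+b (Interlacing-conj il j)))))
        lower : ∀ j → j < y → F j ≋ A j
        lower j j<y = ≋-trans (≡⇒≋ (≡.trans (cellFactor-inserted x j λ′ (y ∷ μ) (<-trans j<y y<r))
          (≡.cong (cellFactor x r j (l + conj λ′ j))
                  (≡.trans (≡.cong (k +_) (conj-∷-< μ j<y)) (+-suc k (conj μ j))))))
          (cellFactor-periodic x r j (conj λ′ j) (conj μ j))

    ψRows-∪ : ∀ {λ′ μ} → Interlacing λ′ μ →
              ψRows (λ′ ∪ r ^ l) (μ ∪ r ^ l) ≋ (ψRows λ′ μ *P correction λ′ μ)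
    ψRows-∪ nil = ≋-trans (ψRows-∪-front z≤n 0<r) (≋-sym (*P-identityˡ 1P))
    ψRows-∪ (single x) with x <? r
    ... | yes x<r = ≋-trans (ψRows-∪-front z≤n x<r) (≋-sym (*P-identityˡ 1P))
    ... | no  x≮r = begin
      ψRows ((x ∷ []) ∪ r ^ l) ([] ∪ r ^ l)                    ≈⟨ ψRows-≡ (∪-between [] l r≤x 0<r) (∪-< [] l 0<r) ⟩
      ψRows (x ∷ (replicate l r ++ [])) (replicate l r ++ [])  ≈⟨ ψRows-∪-between-single r≤x ⟩
      1P                                                       ≈⟨ *P-identityˡ 1P ⟨
      1P *P 1P                                                 ∎
      where
      open SetoidReasoning ≋-setoid
      r≤x : r ≤ x
      r≤x = ≮⇒≥ x≮r
    ψRows-∪ {x ∷ λ′} {y ∷ μ} (cons y≤x λ′₀≤y il) with y <? r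
    ... | no y≮r = begin
      ψRows ((x ∷ λ′) ∪ r ^ l) ((y ∷ μ) ∪ r ^ l)
        ≈⟨ ψRows-≡ (∪-∷ λ′ l (≤-trans r≤y y≤x)) (∪-∷ μ l r≤y) ⟩
      Π y (λ j → cellFactor x y j (conj (λ′ ∪ r ^ l) j) (conj (μ ∪ r ^ l) j)) *P ψRows (λ′ ∪ r ^ l) (μ ∪ r ^ l)
        ≈⟨ *P-cong (Π-cong y λ j _ → cellFactor-∪ x y j λ′ μ) (ψRows-∪ il) ⟩
      Π y (λ j → cellFactor x y j (conj λ′ j) (conj μ j)) *P (ψRows λ′ μ *P correction λ′ μ)
        ≈⟨ *P-assoc (Π y λ j → cellFactor x y j (conj λ′ j) (conj μ j)) (ψRows λ′ μ) (correction λ′ μ) ⟨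
      ψRows (x ∷ λ′) (y ∷ μ) *P correction λ′ μ
        ≡⟨ ≡.cong (ψRows (x ∷ λ′) (y ∷ μ) *P_) (correction-≮ {x} λ′ μ y≮r) ⟨
      ψRows (x ∷ λ′) (y ∷ μ) *P correction (x ∷ λ′) (y ∷ μ)
        ∎
      where
      open SetoidReasoning ≋-setoid
      r≤y : r ≤ y
      r≤y = ≮⇒≥ y≮r
    ... | yes y<r with x <? r
    ...   | yes x<r = begin
      ψRows ((x ∷ λ′) ∪ r ^ l) ((y ∷ μ) ∪ r ^ l)              ≈⟨ ψRows-∪-front y≤x x<r ⟩
      ψRows (x ∷ λ′) (y ∷ μ)                                  ≈⟨ *P-identityʳ _ ⟨
      ψRows (x ∷ λ′) (y ∷ μ) *P 1P                            ≈⟨ *P-congʳ (ψRows (x ∷ λ′) (y ∷ μ)) no-correction ⟨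
      ψRows (x ∷ λ′) (y ∷ μ) *P correction (x ∷ λ′) (y ∷ μ)   ∎
      where
      open SetoidReasoning ≋-setoid
      no-correction : correction (x ∷ λ′) (y ∷ μ) ≋ 1P
      no-correction = ≋-trans (≡⇒≋ (correction-< {x} λ′ μ y<r))
                              (Π-≋1P y λ j _ → ≡⇒≋ (correctionFactor-≯ {x} j _ _ (<⇒≯ x<r)))
    ...   | no  x≮r = begin
      ψRows ((x ∷ λ′) ∪ r ^ l) ((y ∷ μ) ∪ r ^ l)
        ≈⟨ ψRows-≡ (∪-between λ′ l r≤x (≤-<-trans λ′₀≤y y<r)) (∪-< (y ∷ μ) l y<r) ⟩
      ψRows (x ∷ (replicate l r ++ λ′)) (replicate l r ++ (y ∷ μ))
        ≈⟨ ψRows-∪-between y<r r≤x il ⟩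
      ψRows (x ∷ λ′) (y ∷ μ) *P correctionRow x λ′ y μ
        ≡⟨ ≡.cong (ψRows (x ∷ λ′) (y ∷ μ) *P_) (correction-< {x} λ′ μ y<r) ⟨
      ψRows (x ∷ λ′) (y ∷ μ) *P correction (x ∷ λ′) (y ∷ μ)
        ∎
      where
      open SetoidReasoning ≋-setoid
      r≤x : r ≤ x
      r≤x = ≮⇒≥ x≮r

    ∏P-ψFactor-∪ : ∀ {λ′ μ} → Interlacing λ′ μ →
                   ∏P (map (ψFactor (λ′ ∪ r ^ l) (μ ∪ r ^ l)) (cells (μ ∪ r ^ l)))
                     ≋ (∏P (map (ψFactor λ′ μ) (cells μ)) *P correction λ′ μ)
    ∏P-ψFactor-∪ {λ′} {μ} il = begin
      ∏P (map (ψFactor (λ′ ∪ r ^ l) (μ ∪ r ^ l)) (cells (μ ∪ r ^ l)))  ≈⟨ ∏P-ψFactor (Interlacing-∪ 0<r il l) ⟩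
      ψRows (λ′ ∪ r ^ l) (μ ∪ r ^ l)                                  ≈⟨ ψRows-∪ il ⟩
      ψRows λ′ μ *P correction λ′ μ                                   ≈⟨ *P-cong (∏P-ψFactor il) ≋-refl ⟨
      ∏P (map (ψFactor λ′ μ) (cells μ)) *P correction λ′ μ            ∎
      where open SetoidReasoning ≋-setoid

-- The Pieri weights at t = ζ

0<m∸n∸1 : ∀ {m n} → suc n < m → 0 < m ∸ n ∸ 1
0<m∸n∸1 {suc (suc m)} {zero}  _            = s≤s z≤n
0<m∸n∸1 {suc m}       {suc n} (s≤s 1+n<m) = 0<m∸n∸1 1+n<m

module PieriWeights {c ℓ} (K : Field c ℓ) (ζ : Field.Carrier K) where
  open Field K using (_≈_; _*_; 1#; refl; trans; *-cong; setoid; semiring; -‿cong; *-congʳ; *-identityˡ; +-identityʳ)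
  open FieldOps K
  open PolynomialAlgebra K
  open Products K
  open Exp semiring using (^-homo-*)
  open Nat using (_+_)

  bNumAt bDenAt : ℕ → ℕ → Poly
  bNumAt A L = oneMinus ζ A (suc L)
  bDenAt A L = oneMinus ζ (suc A) L

  module _ (l : ℕ) (ζˡ≈1 : ζ ^ l ≈ 1#) where

    oneMinus-periodic : ∀ A L → oneMinus ζ A (l + L) ≋ oneMinus ζ A L
    oneMinus-periodic A L = +P-cong ≋-refl (mono-cong A (-‿cong (begin
      ζ ^ (l + L)       ≈⟨ ^-homo-* ζ l L ⟩
      ζ ^ l * ζ ^ L     ≈⟨ *-congʳ ζˡ≈1 ⟩
      1# * ζ ^ L        ≈⟨ *-identityˡ _ ⟩
      ζ ^ L             ∎)))
      where open SetoidReasoning setoid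

    bNumAt-periodic : ∀ A L → bNumAt A (l + L) ≋ bNumAt A L
    bNumAt-periodic A L = ≋-trans (≡⇒≋ (≡.cong (oneMinus ζ A) (≡.sym (+-suc l L)))) (oneMinus-periodic A (suc L))

    bDenAt-periodic : ∀ A L → bDenAt A (l + L) ≋ bDenAt A L
    bDenAt-periodic A = oneMinus-periodic (suc A)

  coeff₀-oneMinus : ∀ A L → 0 < A → coeff (oneMinus ζ A L) 0 ≈ 1#
  coeff₀-oneMinus (suc A) L _ = +-identityʳ 1#

  coeff₀-guard : ∀ {p} {P : Set p} (P? : Dec P) t {u} → (P → coeff u 0 ≈ 1#) → coeff (if does P? ∧ t then u else 1P) 0 ≈ 1#
  coeff₀-guard (yes p) true  u₀≈1 = u₀≈1 p
  coeff₀-guard (yes _) false u₀≈1 = refl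
  coeff₀-guard (no _)  t     u₀≈1 = refl

  module DenRows = RowForm K bDenAt bNumAt

  coeff₀-ψDenRows : ∀ λ′ μ → coeff (DenRows.ψRows λ′ μ) 0 ≈ 1#
  coeff₀-ψDenRows λ′       []      = refl
  coeff₀-ψDenRows []       (y ∷ μ) = refl
  coeff₀-ψDenRows (x ∷ λ′) (y ∷ μ) = trans (coeff₀-*P (Π y row) (DenRows.ψRows λ′ μ))
    (trans (*-cong (coeff₀-Π y coeff₀-row) (coeff₀-ψDenRows λ′ μ)) (*-identityˡ 1#))
    where
    row : ℕ → Poly
    row j = DenRows.cellFactor x y j (conj λ′ j) (conj μ j)
    coeff₀-row : ∀ j → j < y → coeff (row j) 0 ≈ 1#
    coeff₀-row j j<y = coeff₀-guard (y <? x) (does (conj λ′ j ≟ conj μ j)) λ y<x →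
      trans (coeff₀-*P (bDenAt (y ∸ j ∸ 1) (conj μ j)) (bNumAt (x ∸ j ∸ 1) (conj λ′ j)))
            (trans (*-cong (coeff₀-oneMinus (suc (y ∸ j ∸ 1)) (conj μ j) (s≤s z≤n))
                           (coeff₀-oneMinus (x ∸ j ∸ 1) (suc (conj λ′ j)) (0<m∸n∸1 (<-≤-trans (s≤s j<y) y<x))))
                   (*-identityˡ 1#))

  ψDen≉0P : ∀ {λ′ μ} → Interlacing λ′ μ → ¬ (Pieri.ψDen K ζ λ′ μ ≈P 0P)
  ψDen≉0P {λ′} {μ} il = coeff₀≈1⇒≉0P {Pieri.ψDen K ζ λ′ μ}
    (trans (coeff-≈ (DenRows.∏P-ψFactor il) 0) (coeff₀-ψDenRows λ′ μ))

proposition4p1 : ∀ {c ℓ} (K : Field c ℓ) → FieldOps.CharZero K →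
    (λ′ μ : List ℕ) → IsPartition λ′ → IsPartition μ → μ ⊆ₚ λ′ → HorizontalStrip λ′ μ →
    (r l : ℕ) → 1 ≤ r → 1 ≤ l →
    (ζ : Field.Carrier K) → FieldOps.PrimitiveRoot K l ζ →
    let open FieldOps K
        open Pieri K
        Λ = λ′ ∪ r ^ l
        M = μ ∪ r ^ l
    in ¬ (ψDen ζ Λ M ≈P 0P) × ¬ (ψDen ζ λ′ μ ≈P 0P)
       × ((ψNum ζ Λ M *P ψDen ζ λ′ μ) ≈P (ψNum ζ λ′ μ *P ψDen ζ Λ M))
proposition4p1 K _ λ′ μ _ _ _ _ r zero _ () ζ _
proposition4p1 K _ λ′ μ pλ′ pμ μ⊆λ′ strip r (suc k) 0<r _ ζ (ζˡ≈1 , _) =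
  ψDen≉0P (Insertion.Interlacing-∪ r 0<r il l) , ψDen≉0P il ,
  coeff-≈ (*P-cross {Pieri.ψNum K ζ λ′ μ} (correction λ′ μ) (Num.∏P-ψFactor-∪ il) (Den.∏P-ψFactor-∪ il))
  where
  open FieldOps K using (_*P_)
  open PolynomialAlgebra K
  open PieriWeights K ζ
  open StripInsertion K (λ A L → bNumAt A L *P bDenAt A L) k r 0<r
  module Num = Weights bNumAt bDenAt (bNumAt-periodic l ζˡ≈1) (bDenAt-periodic l ζˡ≈1) (λ A L → ≋-refl)
  module Den = Weights bDenAt bNumAt (bDenAt-periodic l ζˡ≈1) (bNumAt-periodic l ζˡ≈1) (λ A L → *P-comm _ _)

  il : Interlacing λ′ μ
  il = HorizontalStrip⇒Interlacing pλ′ pμ μ⊆λ′ strip
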